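{- Let $\mathcal K$ be a class of $\mathsf{FL_{ew}}$-algebras such that $\mathbf 2\in\mathcal K$ and $\mathcal K$ is closed under ordinal sums. If $\mathbf A\in\mathcal K$ is projective in $\mathcal K$, then $1$ is join irreducible in $\mathbf A$. If moreover $\mathbf A$ is finite, then $\mathbf A$ is subdirectly irreducible.
   Context: $\mathsf{FL_{ew}}$-algebras are bounded commutative integral residuated lattices $\langle A,\vee,\wedge,\cdot,\rightarrow,0,1\rangle$; $\mathbf 2$ is the two-element Boolean algebra. Ordinal sum $\mathbf A_0\oplus\mathbf A_1$ ($A_0\cap A_1=\{1\}$, $\mathbf A_1$ taken as a $0$-free reduct): universe $A_0\cup A_1$; $a\le b$ iff $b=1$, or $a\in A_0\setminus\{1\}$, $b\in A_1\setminus\{1\}$, or $a,b$ in the same component with $a\le b$ there; $a\cdot b=a$ for $a\in A_0\setminus\{1\}$, $b\in A_1$, component product otherwise; $a\rightarrow b=b$ for $a\in A_1$, $b\in A_0\setminus\{1\}$, $=1$ for $a\in A_0\setminus\{1\}$, $b\in A_1$, component implication otherwise; if $a,b\in A_0$ with $a\vee_{A_0}b=1$ their join is the least element of $A_1$; the $0$ is that of $\mathbf A_0$. $\mathcal K$ is closed under ordinal sums if $\mathbf A_0\oplus\mathbf A_1\in\mathcal K$ whenever $\mathbf A_0,\mathbf A_1\in\mathcal K$. Projective in $\mathcal K$: for all $\mathbf B,\mathbf C\in\mathcal K$, homomorphism $h:\mathbf A\to\mathbf C$ and surjective homomorphism $g:\mathbf B\to\mathbf C$, there is a homomorphism $f:\mathbf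 A\to\mathbf B$ with $h=gf$. $1$ is join irreducible if $a\vee b=1$ implies $a=1$ or $b=1$. -}

module Defs where

open import Level using (Level; _⊔_; Lift; lift; lower) renaming (suc to lsuc)
open import Data.Bool using (Bool; true; false; _∧_; _∨_; not)
open import Data.Sum using (_⊎_; inj₁; inj₂)
open import Data.Product using (Σ; _×_; _,_; ∃)
open import Data.Nat using (ℕ)
open import Data.Fin using (Fin)
open import Data.Empty using (⊥)
open import Relation.Nullary using (¬_; Dec; yes; no)
open import Relation.Binary.PropositionalEquality using (_≡_)
open import Algebra.Core using (Op₂)
open import Algebra.Structures using (IsCommutativeMonoid)
open import Algebra.Lattice.Structures using (IsLattice)
open import Axiom.ExcludedMiddle using (ExcludedMiddle)
open import Function.Bundles using (_↔_; Inverse)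
open import Function.Definitions using (Surjective)

record FLew (a : Level) : Set (lsuc a) where
  infixr 6 _⊔'_
  infixr 7 _⊓'_
  infixr 8 _·_
  infixr 5 _⇒_
  field
    Carrier : Set a
    _⊔'_    : Op₂ Carrier
    _⊓'_    : Op₂ Carrier
    _·_     : Op₂ Carrier
    _⇒_     : Op₂ Carrier
    0#      : Carrier
    1#      : Carrier
    isLattice           : IsLattice _≡_ _⊔'_ _⊓'_
    isCommutativeMonoid : IsCommutativeMonoid _≡_ _·_ 1#
    -- lattice order: x ≤ y iff x ⊓ y ≡ x
    residuation₁ : ∀ x y z → (x · y) ⊓' z ≡ x · y → y ⊓' (x ⇒ z) ≡ y
    residuation₂ : ∀ x y z → y ⊓' (x ⇒ z) ≡ y → (x · y) ⊓' z ≡ x · y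
    0-least      : ∀ x → 0# ⊓' x ≡ 0#
    1-greatest   : ∀ x → x ⊓' 1# ≡ x

record RawFL (a : Level) : Set (lsuc a) where
  field
    Carrier : Set a
    _⊔'_ _⊓'_ _·_ _⇒_ : Op₂ Carrier
    0# 1# : Carrier

raw : ∀ {a} → FLew a → RawFL a
raw A = record { Carrier = Carrier ; _⊔'_ = _⊔'_ ; _⊓'_ = _⊓'_ ; _·_ = _·_
               ; _⇒_ = _⇒_ ; 0# = 0# ; 1# = 1# }
  where open FLew A

record RawIso {a b : Level} (R : RawFL a) (S : RawFL b) : Set (a ⊔ b) where
  private
    module R = RawFL R
    module S = RawFL S
  field
    bij    : R.Carrier ↔ S.Carrier
  open Inverse bij public using (to)
  field
    pres-⊔ : ∀ x y → to (x R.⊔' y) ≡ to x S.⊔' to y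
    pres-⊓ : ∀ x y → to (x R.⊓' y) ≡ to x S.⊓' to y
    pres-· : ∀ x y → to (x R.· y) ≡ to x S.· to y
    pres-⇒ : ∀ x y → to (x R.⇒ y) ≡ to x S.⇒ to y
    pres-0 : to R.0# ≡ S.0#
    pres-1 : to R.1# ≡ S.1#

two : ∀ a → RawFL a
two a = record
  { Carrier = Lift a Bool
  ; _⊔'_ = λ x y → lift (lower x ∨ lower y)
  ; _⊓'_ = λ x y → lift (lower x ∧ lower y)
  ; _·_  = λ x y → lift (lower x ∧ lower y)
  ; _⇒_  = λ x y → lift (not (lower x) ∨ lower y)
  ; 0#   = lift false
  ; 1#   = lift true
  }

-- Ordinal sum A₀ ⊕ A₁.  Universe: (A₀ ∖ {1}) ⊎ A₁, the 1 of A₀ being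
-- identified with the 1 of A₁.  Deciding whether an element of A₀ is 1
-- uses excluded middle (the paper works classically).

record Low {a : Level} (A₀ : FLew a) : Set a where
  constructor low
  field
    elt : FLew.Carrier A₀
    .ne : ¬ (elt ≡ FLew.1# A₀)

module OrdinalSum {a : Level} (em : ExcludedMiddle a) (A₀ A₁ : FLew a) where
  private
    module A₀ = FLew A₀
    module A₁ = FLew A₁

  Car : Set a
  Car = Low A₀ ⊎ A₁.Carrier

  ι₀ : A₀.Carrier → Car
  ι₀ x with em {x ≡ A₀.1#}
  ... | yes _ = inj₂ A₁.1#
  ... | no ¬p = inj₁ (low x ¬p)

  join : Op₂ Car
  join (inj₁ (low x _)) (inj₁ (low y _)) with em {(x A₀.⊔' y) ≡ A₀.1#}
  ... | yes _ = inj₂ A₁.0#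
  ... | no ¬p = inj₁ (low (x A₀.⊔' y) ¬p)
  join (inj₁ _) (inj₂ y) = inj₂ y
  join (inj₂ x) (inj₁ _) = inj₂ x
  join (inj₂ x) (inj₂ y) = inj₂ (x A₁.⊔' y)

  meet : Op₂ Car
  meet (inj₁ (low x _)) (inj₁ (low y _)) = ι₀ (x A₀.⊓' y)
  meet (inj₁ x) (inj₂ _) = inj₁ x
  meet (inj₂ _) (inj₁ y) = inj₁ y
  meet (inj₂ x) (inj₂ y) = inj₂ (x A₁.⊓' y)

  prod : Op₂ Car
  prod (inj₁ (low x _)) (inj₁ (low y _)) = ι₀ (x A₀.· y)
  prod (inj₁ x) (inj₂ _) = inj₁ x
  prod (inj₂ _) (inj₁ y) = inj₁ y
  prod (inj₂ x) (inj₂ y) = inj₂ (x A₁.· y)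

  impl : Op₂ Car
  impl (inj₁ (low x _)) (inj₁ (low y _)) = ι₀ (x A₀.⇒ y)
  impl (inj₁ _) (inj₂ _) = inj₂ A₁.1#
  impl (inj₂ _) (inj₁ y) = inj₁ y
  impl (inj₂ x) (inj₂ y) = inj₂ (x A₁.⇒ y)

  ordSum : RawFL a
  ordSum = record
    { Carrier = Car ; _⊔'_ = join ; _⊓'_ = meet ; _·_ = prod ; _⇒_ = impl
    ; 0# = ι₀ A₀.0# ; 1# = inj₂ A₁.1# }

_⊕[_]_ : ∀ {a} → FLew a → ExcludedMiddle a → FLew a → RawFL a
A₀ ⊕[ em ] A₁ = OrdinalSum.ordSum em A₀ A₁

Class : ∀ a k → Set (lsuc a ⊔ lsuc k)
Class a k = FLew a → Set k

Contains2 : ∀ {a k} → Class a k → Set (lsuc a ⊔ k)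
Contains2 {a} K = Σ (FLew a) λ D → K D × RawIso (raw D) (two a)

ClosedUnderOrdinalSums : ∀ {a k} → ExcludedMiddle a → Class a k → Set (lsuc a ⊔ k)
ClosedUnderOrdinalSums {a} em K =
  ∀ (A₀ A₁ : FLew a) → K A₀ → K A₁ →
  Σ (FLew a) λ D → K D × RawIso (raw D) (A₀ ⊕[ em ] A₁)

record Hom {a b : Level} (A : FLew a) (B : FLew b) : Set (a ⊔ b) where
  private
    module A = FLew A
    module B = FLew B
  field
    fun    : A.Carrier → B.Carrier
    pres-⊔ : ∀ x y → fun (x A.⊔' y) ≡ fun x B.⊔' fun y
    pres-⊓ : ∀ x y → fun (x A.⊓' y) ≡ fun x B.⊓' fun y
    pres-· : ∀ x y → fun (x A.· y) ≡ fun x B.· fun y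
    pres-⇒ : ∀ x y → fun (x A.⇒ y) ≡ fun x B.⇒ fun y
    pres-0 : fun A.0# ≡ B.0#
    pres-1 : fun A.1# ≡ B.1#

open Hom public using (fun)

Projective : ∀ {a k} → Class a k → FLew a → Set (lsuc a ⊔ k)
Projective {a} K A =
  ∀ (B C : FLew a) → K B → K C →
  (h : Hom A C) (g : Hom B C) → Surjective _≡_ _≡_ (fun g) →
  Σ (Hom A B) λ f → ∀ x → fun h x ≡ fun g (fun f x)

OneJoinIrreducible : ∀ {a} → FLew a → Set a
OneJoinIrreducible A = ∀ x y → x ⊔' y ≡ 1# → x ≡ 1# ⊎ y ≡ 1#
  where open FLew A

Finite : ∀ {a} → FLew a → Set a
Finite A = Σ ℕ λ n → FLew.Carrier A ↔ Fin n

record Congruence {a : Level} (A : FLew a) : Set (lsuc a) where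
  open FLew A
  field
    R      : Carrier → Carrier → Set a
    refl'  : ∀ x → R x x
    sym'   : ∀ {x y} → R x y → R y x
    trans' : ∀ {x y z} → R x y → R y z → R x z
    cong-⊔ : ∀ {x x' y y'} → R x x' → R y y' → R (x ⊔' y) (x' ⊔' y')
    cong-⊓ : ∀ {x x' y y'} → R x x' → R y y' → R (x ⊓' y) (x' ⊓' y')
    cong-· : ∀ {x x' y y'} → R x x' → R y y' → R (x · y) (x' · y')
    cong-⇒ : ∀ {x x' y y'} → R x x' → R y y' → R (x ⇒ y) (x' ⇒ y')

NonIdentity : ∀ {a} {A : FLew a} → Congruence A → Set a
NonIdentity {A = A} θ =
  Σ (FLew.Carrier A) λ x → Σ (FLew.Carrier A) λ y → Congruence.R θ x y × ¬ (x ≡ y)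

_⊆ᶜ_ : ∀ {a} {A : FLew a} → Congruence A → Congruence A → Set a
θ ⊆ᶜ ψ = ∀ x y → Congruence.R θ x y → Congruence.R ψ x y

SubdirectlyIrreducible : ∀ {a} → FLew a → Set (lsuc a)
SubdirectlyIrreducible A =
  Σ (Congruence A) λ μ → NonIdentity μ ×
    (∀ (ψ : Congruence A) → NonIdentity ψ → μ ⊆ᶜ ψ)

{-# OPTIONS --safe #-}

-- Collapsing the upper component of A ⊕ D to 1 is a surjective homomorphism onto A;
-- if A is projective it has a section s.  When x ⊔ y = 1 with x, y ≠ 1, the elements
-- s x and s y lie in the lower component and their join in A ⊕ D is the bottom of D,
-- while s (x ⊔ y) = s 1 is the top of D; this is impossible as soon as D is nontrivial.
-- For finite A with 1 join irreducible, the join c of all elements other than 1 is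
-- again below 1, so the congruence generated by (c, 1) is the monolith: any congruence
-- identifying x ≠ y identifies the biresiduum (x ⇒ y) ⊓ (y ⇒ x) ≤ c with 1, hence c with 1.
-- That c ≠ 1 also needs A nontrivial: 2 maps onto the trivial algebra, and a section of
-- that map would be a homomorphism from the trivial algebra to 2.

module Submission where

open import Defs
open import Level using (Level)
open import Function using (_∘_)
open import Data.Product using (_×_; _,_; Σ)
open import Data.Sum using (_⊎_; inj₁; inj₂; [_,_])
open import Data.Sum.Properties using (inj₂-injective)
open import Data.Empty using (⊥-elim)
open import Data.List using (List; []; _∷_; map; allFin)
open import Data.List.Membership.Propositional using (_∈_)
open import Data.List.Relation.Unary.Any using (here; there)
open import Data.List.Membership.Propositional.Properties using (∈-map⁺; ∈-allFin)
open import Relation.Nullary using (¬_; yes; no)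
open import Relation.Binary.PropositionalEquality hiding ([_])
open import Axiom.ExcludedMiddle using (ExcludedMiddle)
open import Algebra.Structures using (IsCommutativeMonoid)
open import Algebra.Lattice.Structures using (IsLattice)
open import Algebra.Lattice.Bundles using (Lattice)
import Algebra.Lattice.Properties.Lattice as LatticeProperties
open import Function.Bundles using (Inverse)
open import Function.Definitions using (Surjective)

module FLewProperties {a : Level} (A : FLew a) where
  open FLew A
  open IsLattice isLattice public using (∨-comm; ∨-assoc; ∧-comm; ∧-assoc; ∨-absorbs-∧)
  open IsCommutativeMonoid isCommutativeMonoid public
    using () renaming (identityˡ to ·-identityˡ; identityʳ to ·-identityʳ)

  lattice : Lattice a a
  lattice = record { isLattice = isLattice }

  open LatticeProperties lattice public
    using () renaming (∨-idem to ⊔-idem; ∧-idem to ⊓-idem)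

  infix 4 _≤_
  _≤_ : Carrier → Carrier → Set a
  x ≤ y = x ⊓' y ≡ x

  ≤-antisym : ∀ {x y} → x ≤ y → y ≤ x → x ≡ y
  ≤-antisym {x} {y} x≤y y≤x = trans (sym x≤y) (trans (∧-comm x y) y≤x)

  residuated : ∀ {x y z} → x · y ≤ z → y ≤ x ⇒ z
  residuated {x} {y} {z} = residuation₁ x y z

  residuated⁻ : ∀ {x y z} → y ≤ x ⇒ z → x · y ≤ z
  residuated⁻ {x} {y} {z} = residuation₂ x y z

  1≤⇒≡1 : ∀ {z} → 1# ≤ z → z ≡ 1#
  1≤⇒≡1 {z} = ≤-antisym (1-greatest z)

  ⊓-identityˡ : ∀ x → 1# ⊓' x ≡ x
  ⊓-identityˡ x = trans (∧-comm 1# x) (1-greatest x)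

  ⊔-zeroˡ : ∀ x → 1# ⊔' x ≡ 1#
  ⊔-zeroˡ x = trans (cong (1# ⊔'_) (sym (⊓-identityˡ x))) (∨-absorbs-∧ 1# x)

  ⊔-zeroʳ : ∀ x → x ⊔' 1# ≡ 1#
  ⊔-zeroʳ x = trans (∨-comm x 1#) (⊔-zeroˡ x)

  ⊓≡1⇒≡1ˡ : ∀ {x y} → x ⊓' y ≡ 1# → x ≡ 1#
  ⊓≡1⇒≡1ˡ {x} {y} x⊓y≡1 = begin
    x               ≡⟨ 1-greatest x ⟨
    x ⊓' 1#         ≡⟨ cong (x ⊓'_) x⊓y≡1 ⟨
    x ⊓' (x ⊓' y)   ≡⟨ ∧-assoc x x y ⟨
    (x ⊓' x) ⊓' y   ≡⟨ cong (_⊓' y) (⊓-idem x) ⟩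
    x ⊓' y          ≡⟨ x⊓y≡1 ⟩
    1#              ∎
    where open ≡-Reasoning

  ⇒-zeroʳ : ∀ x → x ⇒ 1# ≡ 1#
  ⇒-zeroʳ x = 1≤⇒≡1 (residuated (1-greatest (x · 1#)))

  x·1≤x : ∀ x → x · 1# ≤ x
  x·1≤x x = subst (_≤ x) (sym (·-identityʳ x)) (⊓-idem x)

  ⇒-diag : ∀ x → x ⇒ x ≡ 1#
  ⇒-diag x = 1≤⇒≡1 (residuated (x·1≤x x))

  ⇒-identityˡ : ∀ y → 1# ⇒ y ≡ y
  ⇒-identityˡ y = ≤-antisym 1⇒y≤y y≤1⇒y
    where
    1⇒y≤y : 1# ⇒ y ≤ y
    1⇒y≤y = subst (_≤ y) (·-identityˡ _) (residuated⁻ (⊓-idem (1# ⇒ y)))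
    y≤1⇒y : y ≤ 1# ⇒ y
    y≤1⇒y = residuated (subst (_≤ y) (sym (·-identityˡ y)) (⊓-idem y))

  ⇒≡1⇒≤ : ∀ {x y} → x ⇒ y ≡ 1# → x ≤ y
  ⇒≡1⇒≤ {x} {y} x⇒y≡1 =
    subst (_≤ y) (·-identityʳ x) (residuated⁻ (subst (1# ≤_) (sym x⇒y≡1) (⊓-idem 1#)))

  biresiduum≡1⇒≡ : ∀ {x y} → (x ⇒ y) ⊓' (y ⇒ x) ≡ 1# → x ≡ y
  biresiduum≡1⇒≡ {x} {y} e =
    ≤-antisym (⇒≡1⇒≤ (⊓≡1⇒≡1ˡ e)) (⇒≡1⇒≤ (⊓≡1⇒≡1ˡ (trans (∧-comm _ _) e)))

  0≡1⇒≡1 : 0# ≡ 1# → ∀ x → x ≡ 1#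
  0≡1⇒≡1 0≡1 x = trans (sym (⊓-identityˡ x)) (subst (λ e → e ⊓' x ≡ e) 0≡1 (0-least x))

  data Cg (c : Carrier) : Carrier → Carrier → Set a where
    Cg-gen   : Cg c c 1#
    Cg-refl  : ∀ x → Cg c x x
    Cg-sym   : ∀ {x y} → Cg c x y → Cg c y x
    Cg-trans : ∀ {x y z} → Cg c x y → Cg c y z → Cg c x z
    Cg-⊔     : ∀ {x x' y y'} → Cg c x x' → Cg c y y' → Cg c (x ⊔' y) (x' ⊔' y')
    Cg-⊓     : ∀ {x x' y y'} → Cg c x x' → Cg c y y' → Cg c (x ⊓' y) (x' ⊓' y')
    Cg-·     : ∀ {x x' y y'} → Cg c x x' → Cg c y y' → Cg c (x · y) (x' · y')
    Cg-⇒     : ∀ {x x' y y'} → Cg c x x' → Cg c y y' → Cg c (x ⇒ y) (x' ⇒ y')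

  Cg-congruence : Carrier → Congruence A
  Cg-congruence c = record
    { R = Cg c ; refl' = Cg-refl ; sym' = Cg-sym ; trans' = Cg-trans
    ; cong-⊔ = Cg-⊔ ; cong-⊓ = Cg-⊓ ; cong-· = Cg-· ; cong-⇒ = Cg-⇒ }

  Cg-least : ∀ {c} (ψ : Congruence A) → Congruence.R ψ c 1# → Cg-congruence c ⊆ᶜ ψ
  Cg-least {c} ψ c≡1 = go
    where
    open Congruence ψ
    go : ∀ x y → Cg c x y → R x y
    go _ _ Cg-gen         = c≡1
    go _ _ (Cg-refl x)    = refl' x
    go _ _ (Cg-sym p)     = sym' (go _ _ p)
    go _ _ (Cg-trans p q) = trans' (go _ _ p) (go _ _ q)
    go _ _ (Cg-⊔ p q)     = cong-⊔ (go _ _ p) (go _ _ q)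
    go _ _ (Cg-⊓ p q)     = cong-⊓ (go _ _ p) (go _ _ q)
    go _ _ (Cg-· p q)     = cong-· (go _ _ p) (go _ _ q)
    go _ _ (Cg-⇒ p q)     = cong-⇒ (go _ _ p) (go _ _ q)

  Cg-⊆-nonIdentity : ∀ {c} → (∀ y → ¬ (y ≡ 1#) → y ⊔' c ≡ c)
    → (ψ : Congruence A) → NonIdentity ψ → Cg-congruence c ⊆ᶜ ψ
  Cg-⊆-nonIdentity {c} below-c ψ (x , y , x~y , x≢y) = Cg-least ψ c~1
    where
    open Congruence ψ
    d~1 : R ((x ⇒ y) ⊓' (y ⇒ x)) 1#
    d~1 = subst (R _) (trans (⊓-idem _) (⇒-diag y))
            (cong-⊓ (cong-⇒ x~y (refl' y)) (cong-⇒ (refl' y) x~y))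
    c~1 : R c 1#
    c~1 = subst₂ R (below-c _ (x≢y ∘ biresiduum≡1⇒≡)) (⊔-zeroˡ c) (cong-⊔ d~1 (refl' c))

  module _ (em : ExcludedMiddle a) where

    ⋁≢1 : List Carrier → Carrier
    ⋁≢1 [] = 0#
    ⋁≢1 (x ∷ xs) with em {x ≡ 1#}
    ... | yes _ = ⋁≢1 xs
    ... | no  _ = x ⊔' ⋁≢1 xs

    ⋁≢1-≢1 : ¬ (0# ≡ 1#) → OneJoinIrreducible A → ∀ xs → ¬ (⋁≢1 xs ≡ 1#)
    ⋁≢1-≢1 0≢1 ji [] = 0≢1
    ⋁≢1-≢1 0≢1 ji (x ∷ xs) with em {x ≡ 1#}
    ... | yes _ = ⋁≢1-≢1 0≢1 ji xs
    ... | no x≢1 = λ e → [ x≢1 , ⋁≢1-≢1 0≢1 ji xs ] (ji x (⋁≢1 xs) e)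

    ≤-⋁≢1 : ∀ xs y → y ∈ xs → ¬ (y ≡ 1#) → y ⊔' ⋁≢1 xs ≡ ⋁≢1 xs
    ≤-⋁≢1 (x ∷ xs) y y∈ y≢1 with em {x ≡ 1#}
    ≤-⋁≢1 (x ∷ xs) y (here refl) y≢1 | yes x≡1 = ⊥-elim (y≢1 x≡1)
    ≤-⋁≢1 (x ∷ xs) y (there y∈) y≢1 | yes _ = ≤-⋁≢1 xs y y∈ y≢1
    ≤-⋁≢1 (x ∷ xs) y (here refl) y≢1 | no _ =
      trans (sym (∨-assoc y y _)) (cong (_⊔' ⋁≢1 xs) (⊔-idem y))
    ≤-⋁≢1 (x ∷ xs) y (there y∈) y≢1 | no _ = begin
      y ⊔' (x ⊔' ⋁≢1 xs)   ≡⟨ ∨-assoc y x _ ⟨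
      (y ⊔' x) ⊔' ⋁≢1 xs   ≡⟨ cong (_⊔' ⋁≢1 xs) (∨-comm y x) ⟩
      (x ⊔' y) ⊔' ⋁≢1 xs   ≡⟨ ∨-assoc x y _ ⟩
      x ⊔' (y ⊔' ⋁≢1 xs)   ≡⟨ cong (x ⊔'_) (≤-⋁≢1 xs y y∈ y≢1) ⟩
      x ⊔' ⋁≢1 xs          ∎
      where open ≡-Reasoning

    finite-oneJoinIrreducible⇒subdirectlyIrreducible :
      ¬ (0# ≡ 1#) → OneJoinIrreducible A → Finite A → SubdirectlyIrreducible A
    finite-oneJoinIrreducible⇒subdirectlyIrreducible 0≢1 ji (n , A↔Fin) =
      Cg-congruence c , (c , 1# , Cg-gen , ⋁≢1-≢1 0≢1 ji elements) , Cg-⊆-nonIdentity below-c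
      where
      open Inverse A↔Fin
      elements : List Carrier
      elements = map from (allFin n)
      c : Carrier
      c = ⋁≢1 elements
      below-c : ∀ y → ¬ (y ≡ 1#) → y ⊔' c ≡ c
      below-c y = ≤-⋁≢1 elements y
        (subst (_∈ elements) (strictlyInverseʳ y) (∈-map⁺ from (∈-allFin (to y))))

module Collapse {a : Level} (em : ExcludedMiddle a) (A₀ A₁ : FLew a) where
  open FLew A₀
  open FLewProperties A₀
  open OrdinalSum em A₀ A₁
  private module A₁ = FLew A₁

  collapse : Car → Carrier
  collapse (inj₁ x) = Low.elt x
  collapse (inj₂ _) = 1#

  collapse-ι₀ : ∀ x → collapse (ι₀ x) ≡ x
  collapse-ι₀ x with em {x ≡ 1#}
  ... | yes x≡1 = sym x≡1
  ... | no  _   = refl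

  collapse-join : ∀ u v → collapse (join u v) ≡ collapse u ⊔' collapse v
  collapse-join (inj₁ (low x _)) (inj₁ (low y _)) with em {(x ⊔' y) ≡ 1#}
  ... | yes x⊔y≡1 = sym x⊔y≡1
  ... | no  _     = refl
  collapse-join (inj₁ (low x _)) (inj₂ _) = sym (⊔-zeroʳ x)
  collapse-join (inj₂ _) (inj₁ (low y _)) = sym (⊔-zeroˡ y)
  collapse-join (inj₂ _) (inj₂ _)         = sym (⊔-idem 1#)

  collapse-meet : ∀ u v → collapse (meet u v) ≡ collapse u ⊓' collapse v
  collapse-meet (inj₁ (low x _)) (inj₁ (low y _)) = collapse-ι₀ _
  collapse-meet (inj₁ (low x _)) (inj₂ _)         = sym (1-greatest x)
  collapse-meet (inj₂ _) (inj₁ (low y _))         = sym (⊓-identityˡ y)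
  collapse-meet (inj₂ _) (inj₂ _)                 = sym (⊓-idem 1#)

  collapse-prod : ∀ u v → collapse (prod u v) ≡ collapse u · collapse v
  collapse-prod (inj₁ (low x _)) (inj₁ (low y _)) = collapse-ι₀ _
  collapse-prod (inj₁ (low x _)) (inj₂ _)         = sym (·-identityʳ x)
  collapse-prod (inj₂ _) (inj₁ (low y _))         = sym (·-identityˡ y)
  collapse-prod (inj₂ _) (inj₂ _)                 = sym (·-identityʳ 1#)

  collapse-impl : ∀ u v → collapse (impl u v) ≡ collapse u ⇒ collapse v
  collapse-impl (inj₁ (low x _)) (inj₁ (low y _)) = collapse-ι₀ _
  collapse-impl (inj₁ (low x _)) (inj₂ _)         = sym (⇒-zeroʳ x)
  collapse-impl (inj₂ _) (inj₁ (low y _))         = sym (⇒-identityˡ y)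
  collapse-impl (inj₂ _) (inj₂ _)                 = sym (⇒-zeroʳ 1#)

  join-overflow : ∀ u v → ¬ (collapse u ≡ 1#) → ¬ (collapse v ≡ 1#)
    → collapse u ⊔' collapse v ≡ 1# → join u v ≡ inj₂ A₁.0#
  join-overflow (inj₁ (low x _)) (inj₁ (low y _)) _ _ x⊔y≡1 with em {(x ⊔' y) ≡ 1#}
  ... | yes _     = refl
  ... | no  x⊔y≢1 = ⊥-elim (x⊔y≢1 x⊔y≡1)
  join-overflow (inj₁ _) (inj₂ _) _ v≢1 _ = ⊥-elim (v≢1 refl)
  join-overflow (inj₂ _) _ u≢1 _ _        = ⊥-elim (u≢1 refl)

  section⇒oneJoinIrreducible : ¬ (A₁.0# ≡ A₁.1#)
    → (s : Carrier → Car) → (∀ x → collapse (s x) ≡ x)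
    → (∀ x y → s (x ⊔' y) ≡ join (s x) (s y)) → s 1# ≡ inj₂ A₁.1#
    → OneJoinIrreducible A₀
  section⇒oneJoinIrreducible A₁-nontrivial s collapse-s s-⊔ s-1 x y x⊔y≡1
    with em {x ≡ 1#} | em {y ≡ 1#}
  ... | yes x≡1 | _       = inj₁ x≡1
  ... | no _    | yes y≡1 = inj₂ y≡1
  ... | no x≢1  | no y≢1  = ⊥-elim (A₁-nontrivial (inj₂-injective (begin
    inj₂ A₁.0#         ≡⟨ join-overflow (s x) (s y) (x≢1 ∘ trans (sym (collapse-s x)))
                            (y≢1 ∘ trans (sym (collapse-s y)))
                            (trans (cong₂ _⊔'_ (collapse-s x) (collapse-s y)) x⊔y≡1) ⟨
    join (s x) (s y)   ≡⟨ s-⊔ x y ⟨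
    s (x ⊔' y)         ≡⟨ cong s x⊔y≡1 ⟩
    s 1#               ≡⟨ s-1 ⟩
    inj₂ A₁.1#         ∎)))
    where open ≡-Reasoning

  module _ (S : FLew a) (S≅A₀⊕A₁ : RawIso (raw S) ordSum) where
    open RawIso S≅A₀⊕A₁ using (to)

    collapseHom : Hom S A₀
    collapseHom = record
      { fun    = collapse ∘ to
      ; pres-⊔ = λ x y → trans (cong collapse (RawIso.pres-⊔ S≅A₀⊕A₁ x y)) (collapse-join (to x) (to y))
      ; pres-⊓ = λ x y → trans (cong collapse (RawIso.pres-⊓ S≅A₀⊕A₁ x y)) (collapse-meet (to x) (to y))
      ; pres-· = λ x y → trans (cong collapse (RawIso.pres-· S≅A₀⊕A₁ x y)) (collapse-prod (to x) (to y))
      ; pres-⇒ = λ x y → trans (cong collapse (RawIso.pres-⇒ S≅A₀⊕A₁ x y)) (collapse-impl (to x) (to y))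
      ; pres-0 = trans (cong collapse (RawIso.pres-0 S≅A₀⊕A₁)) (collapse-ι₀ 0#)
      ; pres-1 = cong collapse (RawIso.pres-1 S≅A₀⊕A₁) }

    collapseHom-surjective : Surjective _≡_ _≡_ (fun collapseHom)
    collapseHom-surjective y = from (ι₀ y) , λ { refl →
      trans (cong collapse (strictlyInverseˡ (ι₀ y))) (collapse-ι₀ y) }
      where open Inverse (RawIso.bij S≅A₀⊕A₁) using (from; strictlyInverseˡ)

id-Hom : ∀ {a} (A : FLew a) → Hom A A
id-Hom A = record
  { fun = λ x → x ; pres-⊔ = λ _ _ → refl ; pres-⊓ = λ _ _ → refl
  ; pres-· = λ _ _ → refl ; pres-⇒ = λ _ _ → refl ; pres-0 = refl ; pres-1 = refl }

hom-to-trivial : ∀ {a b} (B : FLew b) (A : FLew a) → FLew.0# A ≡ FLew.1# A → Hom B A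
hom-to-trivial B A 0≡1 = record
  { fun    = λ _ → 1#
  ; pres-⊔ = λ _ _ → 1≡ (1# ⊔' 1#)
  ; pres-⊓ = λ _ _ → 1≡ (1# ⊓' 1#)
  ; pres-· = λ _ _ → 1≡ (1# · 1#)
  ; pres-⇒ = λ _ _ → 1≡ (1# ⇒ 1#)
  ; pres-0 = sym 0≡1
  ; pres-1 = refl }
  where
  open FLew A
  open FLewProperties A

  1≡ : ∀ x → 1# ≡ x
  1≡ x = sym (0≡1⇒≡1 0≡1 x)

hom-preserves-0≡1 : ∀ {a b} {A : FLew a} {B : FLew b} → Hom A B
  → FLew.0# A ≡ FLew.1# A → FLew.0# B ≡ FLew.1# B
hom-preserves-0≡1 f 0≡1 = trans (sym (Hom.pres-0 f)) (trans (cong (fun f) 0≡1) (Hom.pres-1 f))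

two-nontrivial : ∀ {a} (D : FLew a) → RawIso (raw D) (two a) → ¬ (FLew.0# D ≡ FLew.1# D)
two-nontrivial D D≅2 0≡1
  with trans (sym (RawIso.pres-0 D≅2)) (trans (cong (RawIso.to D≅2) 0≡1) (RawIso.pres-1 D≅2))
... | ()

projective⇒retract : ∀ {a k} {K : Class a k} {A B : FLew a} → Projective K A → K A → K B
  → (g : Hom B A) → Surjective _≡_ _≡_ (fun g)
  → Σ (Hom A B) λ f → ∀ x → fun g (fun f x) ≡ x
projective⇒retract {A = A} {B} proj KA KB g g-surjective
  with proj B A KB KA (id-Hom A) g g-surjective
... | f , gf≡id = f , λ x → sym (gf≡id x)

projective⇒nontrivial : ∀ {a k} {K : Class a k} (D : FLew a) → K D → ¬ (FLew.0# D ≡ FLew.1# D)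
  → (A : FLew a) → K A → Projective K A → ¬ (FLew.0# A ≡ FLew.1# A)
projective⇒nontrivial D KD D-nontrivial A KA proj 0≡1 with
  projective⇒retract proj KA KD (hom-to-trivial D A 0≡1)
    (λ y → FLew.1# D , λ _ → sym (FLewProperties.0≡1⇒≡1 A 0≡1 y))
... | f , _ = D-nontrivial (hom-preserves-0≡1 f 0≡1)

projective⇒oneJoinIrreducible : ∀ {a k} (em : ExcludedMiddle a) {K : Class a k}
  → ClosedUnderOrdinalSums em K
  → (D : FLew a) → K D → ¬ (FLew.0# D ≡ FLew.1# D)
  → (A : FLew a) → K A → Projective K A → OneJoinIrreducible A
projective⇒oneJoinIrreducible {a} em {K} closed D KD D-nontrivial A KA proj =
  fromOrdinalSum (closed A D KA KD)
  where
  open Collapse em A D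

  fromOrdinalSum : Σ (FLew a) (λ S → K S × RawIso (raw S) (A ⊕[ em ] D)) → OneJoinIrreducible A
  fromOrdinalSum (S , KS , S≅A⊕D) =
    fromSection (projective⇒retract proj KA KS (collapseHom S S≅A⊕D) (collapseHom-surjective S S≅A⊕D))
    where
    open RawIso S≅A⊕D using (to)

    fromSection : Σ (Hom A S) (λ f → ∀ x → collapse (to (fun f x)) ≡ x) → OneJoinIrreducible A
    fromSection (f , collapse-f) = section⇒oneJoinIrreducible D-nontrivial (to ∘ fun f) collapse-f
      (λ x y → trans (cong to (Hom.pres-⊔ f x y)) (RawIso.pres-⊔ S≅A⊕D _ _))
      (trans (cong to (Hom.pres-1 f)) (RawIso.pres-1 S≅A⊕D))

mainTheorem18 : ∀ {a k : Level} (em : ExcludedMiddle a) (K : Class a k)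
    → Contains2 K → ClosedUnderOrdinalSums em K
    → (A : FLew a) → K A → Projective K A
    → OneJoinIrreducible A × (Finite A → SubdirectlyIrreducible A)
mainTheorem18 em K (D , KD , D≅2) closed A KA proj =
  oneJoinIrreducible ,
  FLewProperties.finite-oneJoinIrreducible⇒subdirectlyIrreducible A em A-nontrivial oneJoinIrreducible
  where
  D-nontrivial : ¬ (FLew.0# D ≡ FLew.1# D)
  D-nontrivial = two-nontrivial D D≅2
  A-nontrivial : ¬ (FLew.0# A ≡ FLew.1# A)
  A-nontrivial = projective⇒nontrivial D KD D-nontrivial A KA proj
  oneJoinIrreducible : OneJoinIrreducible A
  oneJoinIrreducible = projective⇒oneJoinIrreducible em closed D KD D-nontrivial A KA proj
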